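{- The $\lambda\mu$T-calculus satisfies subject reduction: if $\Gamma;\Delta\vdash t:\rho$ and $t\to t'$, then $\Gamma;\Delta\vdash t':\rho$.
   Context: The $\lambda\mu$T-calculus. Types: $\rho,\sigma,\tau ::= \mathbb N \mid \sigma\to\tau$. Over infinite sets of $\lambda$-variables $x,y,\dots$ and $\mu$-variables $\alpha,\beta,\dots$, terms and commands are mutually defined by $t,r,s ::= x \mid \lambda x{:}\rho.r \mid ts \mid \mu\alpha{:}\rho.c \mid 0 \mid \mathsf S\,t \mid \mathsf{nrec}_\rho\ r\ s\ t$ and $c ::= [\alpha]t$ (terms up to renaming of bound variables). $\mathrm{FCV}(t)$ denotes free $\mu$-variables. Numerals: $\overline n := \mathsf S^n 0$. Typing judgments $\Gamma;\Delta\vdash t:\rho$ and $\Gamma;\Delta\vdash c$ ($\Gamma$ assigns types to $\lambda$-variables, $\Delta$ to $\mu$-variables) are generated by: $x:\rho\in\Gamma\Rightarrow\Gamma;\Delta\vdash x:\rho$; $\Gamma,x{:}\sigma;\Delta\vdash t:\tau\Rightarrow\Gamma;\Delta\vdash\lambda x{:}\sigma.t:\sigma\to\tau$; $\Gamma;\Delta\vdash t:\sigma\to\tau$ and $\Gamma;\Delta\vdash s:\sigma\Rightarrow\Gamma;\Delta\vdash ts:\tau$; $\Gamma;\Delta\vdash0:\mathbb N$; $\Gamma;\Delta\vdash t:\mathbb N\Rightarrow\Gamma;\Delta\vdash\mathsf S\,t:\mathbb N$; $\Gamma;\Delta\vdash r:\rho$, $\Gamma;\Delta\vdash s:\mathbb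 N\to\rho\to\rho$, $\Gamma;\Delta\vdash t:\mathbb N\Rightarrow\Gamma;\Delta\vdash\mathsf{nrec}_\rho\ r\ s\ t:\rho$; $\Gamma;\Delta,\alpha{:}\rho\vdash c\Rightarrow\Gamma;\Delta\vdash\mu\alpha{:}\rho.c:\rho$; $\Gamma;\Delta\vdash t:\rho$ and $\alpha:\rho\in\Delta\Rightarrow\Gamma;\Delta\vdash[\alpha]t$. Contexts: $E ::= \Box \mid E\,t \mid \mathsf S\,E \mid \mathsf{nrec}\ r\ s\ E$; $E[t]$ fills the hole. Structural substitution $t[\alpha:=\beta E]$ replaces recursively every subcommand $[\alpha]q$ of $t$ by $[\beta]E[q[\alpha:=\beta E]]$ (capture-avoiding). Reduction $\to$ is the compatible closure (on terms and commands) of: $(\lambda x.t)r \to t[x:=r]$; $\mathsf S(\mu\alpha.c)\to \mu\alpha.c[\alpha:=\alpha(\mathsf S\Box)]$; $(\mu\alpha.c)s\to\mu\alpha.c[\alpha:=\alpha(\Box s)]$; $\mu\alpha.[\alpha]t\to t$ if $\alpha\notin\mathrm{FCV}(t)$; $[\alpha]\mu\beta.c\to c[\beta:=\alpha\,\Box]$; $\mathsf{nrec}\ r\ s\ 0\to r$; $\mathsf{nrec}\ r\ s\ (\mathsf S\,\overline n)\to s\ \overline n\ (\mathsf{nrec}\ r\ s\ \overline n)$; $\mathsf{nrec}\ r\ s\ (\mu\alpha.c)\to\mu\alpha.c[\alpha:=\alpha(\mathsf{nrec}\ r\ s\ \Box)]$. -}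

module Defs where

-- The λμT-calculus, with de Bruijn indices (terms up to α-renaming)
-- for both λ-variables and μ-variables (two separate index spaces).

open import Data.Nat using (ℕ; zero; suc; pred; _≡ᵇ_)
open import Data.Bool using (if_then_else_)
open import Data.List using (List; _∷_)
open import Relation.Nullary using (¬_)

infixr 7 _⇒_
data Ty : Set where
  nat : Ty
  _⇒_ : Ty → Ty → Ty

mutual
  data Term : Set where
    var  : ℕ → Term
    lam  : Ty → Term → Term
    _·_  : Term → Term → Term
    mu   : Ty → Cmd → Term
    ze   : Term
    S    : Term → Term
    nrec : Ty → Term → Term → Term → Term

  data Cmd : Set where
    cmd : ℕ → Term → Cmd               -- [α] t   (α a μ-variable index)

infixl 8 _·_

num : ℕ → Term
num zero    = ze
num (suc n) = S (num n)

lift : (ℕ → ℕ) → ℕ → ℕ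
lift f zero    = zero
lift f (suc n) = suc (f n)

mutual
  renλ : (ℕ → ℕ) → Term → Term
  renλ f (var x)        = var (f x)
  renλ f (lam ρ t)      = lam ρ (renλ (lift f) t)
  renλ f (t · s)        = renλ f t · renλ f s
  renλ f (mu ρ c)       = mu ρ (renλC f c)
  renλ f ze             = ze
  renλ f (S t)          = S (renλ f t)
  renλ f (nrec ρ r s t) = nrec ρ (renλ f r) (renλ f s) (renλ f t)

  renλC : (ℕ → ℕ) → Cmd → Cmd
  renλC f (cmd α t) = cmd α (renλ f t)

mutual
  renμ : (ℕ → ℕ) → Term → Term
  renμ f (var x)        = var x
  renμ f (lam ρ t)      = lam ρ (renμ f t)
  renμ f (t · s)        = renμ f t · renμ f s
  renμ f (mu ρ c)       = mu ρ (renμC (lift f) c)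
  renμ f ze             = ze
  renμ f (S t)          = S (renμ f t)
  renμ f (nrec ρ r s t) = nrec ρ (renμ f r) (renμ f s) (renμ f t)

  renμC : (ℕ → ℕ) → Cmd → Cmd
  renμC f (cmd α t) = cmd (f α) (renμ f t)

exts : (ℕ → Term) → ℕ → Term
exts σ zero    = var zero
exts σ (suc n) = renλ suc (σ n)

mutual
  sub : (ℕ → Term) → Term → Term
  sub σ (var x)        = σ x
  sub σ (lam ρ t)      = lam ρ (sub (exts σ) t)
  sub σ (t · s)        = sub σ t · sub σ s
  sub σ (mu ρ c)       = mu ρ (subC (λ n → renμ suc (σ n)) c)
  sub σ ze             = ze
  sub σ (S t)          = S (sub σ t)
  sub σ (nrec ρ r s t) = nrec ρ (sub σ r) (sub σ s) (sub σ t)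

  subC : (ℕ → Term) → Cmd → Cmd
  subC σ (cmd α t) = cmd α (sub σ t)

single : Term → ℕ → Term
single r zero    = r
single r (suc n) = var n

_[0:=_] : Term → Term → Term
t [0:= r ] = sub (single r) t

data ECtx : Set where
  hole  : ECtx
  appE  : ECtx → Term → ECtx
  sucE  : ECtx → ECtx
  nrecE : Ty → Term → Term → ECtx → ECtx

plug : ECtx → Term → Term
plug hole            u = u
plug (appE E t)      u = plug E u · t
plug (sucE E)        u = S (plug E u)
plug (nrecE ρ r s E) u = nrec ρ r s (plug E u)

renλE : (ℕ → ℕ) → ECtx → ECtx
renλE f hole            = hole
renλE f (appE E t)      = appE (renλE f E) (renλ f t)
renλE f (sucE E)        = sucE (renλE f E)
renλE f (nrecE ρ r s E) = nrecE ρ (renλ f r) (renλ f s) (renλE f E)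

renμE : (ℕ → ℕ) → ECtx → ECtx
renμE f hole            = hole
renμE f (appE E t)      = appE (renμE f E) (renμ f t)
renμE f (sucE E)        = sucE (renμE f E)
renμE f (nrecE ρ r s E) = nrecE ρ (renμ f r) (renμ f s) (renμE f E)

-- structural substitution  t[α := β E]  (α, β μ-variable indices):
-- every subcommand [α]q becomes [β] E[q[α := β E]]; capture-avoiding.
mutual
  ssub : ℕ → ℕ → ECtx → Term → Term
  ssub α β E (var x)        = var x
  ssub α β E (lam ρ t)      = lam ρ (ssub α β (renλE suc E) t)
  ssub α β E (t · s)        = ssub α β E t · ssub α β E s
  ssub α β E (mu ρ c)       = mu ρ (ssubC (suc α) (suc β) (renμE suc E) c)
  ssub α β E ze             = ze
  ssub α β E (S t)          = S (ssub α β E t)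
  ssub α β E (nrec ρ r s t) = nrec ρ (ssub α β E r) (ssub α β E s) (ssub α β E t)

  ssubC : ℕ → ℕ → ECtx → Cmd → Cmd
  ssubC α β E (cmd γ q) =
    if γ ≡ᵇ α then cmd β (plug E (ssub α β E q)) else cmd γ (ssub α β E q)

mutual
  data FreeC : ℕ → Term → Set where
    lam   : ∀ {α ρ t} → FreeC α t → FreeC α (lam ρ t)
    appˡ  : ∀ {α t s} → FreeC α t → FreeC α (t · s)
    appʳ  : ∀ {α t s} → FreeC α s → FreeC α (t · s)
    mu    : ∀ {α ρ c} → FreeCC (suc α) c → FreeC α (mu ρ c)
    S     : ∀ {α t} → FreeC α t → FreeC α (S t)
    nrec₁ : ∀ {α ρ r s t} → FreeC α r → FreeC α (nrec ρ r s t)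
    nrec₂ : ∀ {α ρ r s t} → FreeC α s → FreeC α (nrec ρ r s t)
    nrec₃ : ∀ {α ρ r s t} → FreeC α t → FreeC α (nrec ρ r s t)

  data FreeCC : ℕ → Cmd → Set where
    here  : ∀ {α t} → FreeCC α (cmd α t)
    there : ∀ {α γ t} → FreeC α t → FreeCC α (cmd γ t)

data _∋_∶_ : List Ty → ℕ → Ty → Set where
  here  : ∀ {Γ ρ} → (ρ ∷ Γ) ∋ zero ∶ ρ
  there : ∀ {Γ ρ σ n} → Γ ∋ n ∶ ρ → (σ ∷ Γ) ∋ suc n ∶ ρ

mutual
  data _⨾_⊢_∶_ : List Ty → List Ty → Term → Ty → Set where
    ⊢var  : ∀ {Γ Δ x ρ} → Γ ∋ x ∶ ρ → Γ ⨾ Δ ⊢ var x ∶ ρ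
    ⊢lam  : ∀ {Γ Δ σ τ t} → (σ ∷ Γ) ⨾ Δ ⊢ t ∶ τ → Γ ⨾ Δ ⊢ lam σ t ∶ (σ ⇒ τ)
    ⊢app  : ∀ {Γ Δ σ τ t s} → Γ ⨾ Δ ⊢ t ∶ (σ ⇒ τ) → Γ ⨾ Δ ⊢ s ∶ σ → Γ ⨾ Δ ⊢ t · s ∶ τ
    ⊢ze   : ∀ {Γ Δ} → Γ ⨾ Δ ⊢ ze ∶ nat
    ⊢S    : ∀ {Γ Δ t} → Γ ⨾ Δ ⊢ t ∶ nat → Γ ⨾ Δ ⊢ S t ∶ nat
    ⊢nrec : ∀ {Γ Δ ρ r s t} → Γ ⨾ Δ ⊢ r ∶ ρ → Γ ⨾ Δ ⊢ s ∶ (nat ⇒ ρ ⇒ ρ) →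
            Γ ⨾ Δ ⊢ t ∶ nat → Γ ⨾ Δ ⊢ nrec ρ r s t ∶ ρ
    ⊢mu   : ∀ {Γ Δ ρ c} → Γ ⨾ (ρ ∷ Δ) ⊢c c → Γ ⨾ Δ ⊢ mu ρ c ∶ ρ

  data _⨾_⊢c_ : List Ty → List Ty → Cmd → Set where
    ⊢cmd  : ∀ {Γ Δ α ρ t} → Γ ⨾ Δ ⊢ t ∶ ρ → Δ ∋ α ∶ ρ → Γ ⨾ Δ ⊢c cmd α t

infix 4 _⟶_ _⟶c_ _⨾_⊢_∶_ _⨾_⊢c_ _∋_∶_

mutual
  data _⟶_ : Term → Term → Set where
    β      : ∀ {ρ t r} → lam ρ t · r ⟶ t [0:= r ]
    μS     : ∀ {ρ c} → S (mu ρ c) ⟶ mu ρ (ssubC 0 0 (sucE hole) c)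
    μapp   : ∀ {σ τ c s} → mu (σ ⇒ τ) c · s ⟶ mu τ (ssubC 0 0 (appE hole (renμ suc s)) c)
    μη     : ∀ {ρ t} → ¬ FreeC 0 t → mu ρ (cmd 0 t) ⟶ renμ pred t
    nrec0  : ∀ {ρ r s} → nrec ρ r s ze ⟶ r
    nrecS  : ∀ {ρ r s n} → nrec ρ r s (S (num n)) ⟶ s · num n · nrec ρ r s (num n)
    nrecμ  : ∀ {ρ σ r s c} →
             nrec ρ r s (mu σ c) ⟶ mu ρ (ssubC 0 0 (nrecE ρ (renμ suc r) (renμ suc s) hole) c)
    ξlam   : ∀ {ρ t t'} → t ⟶ t' → lam ρ t ⟶ lam ρ t'
    ξappˡ  : ∀ {t t' s} → t ⟶ t' → t · s ⟶ t' · s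
    ξappʳ  : ∀ {t s s'} → s ⟶ s' → t · s ⟶ t · s'
    ξmu    : ∀ {ρ c c'} → c ⟶c c' → mu ρ c ⟶ mu ρ c'
    ξS     : ∀ {t t'} → t ⟶ t' → S t ⟶ S t'
    ξnrec₁ : ∀ {ρ r r' s t} → r ⟶ r' → nrec ρ r s t ⟶ nrec ρ r' s t
    ξnrec₂ : ∀ {ρ r s s' t} → s ⟶ s' → nrec ρ r s t ⟶ nrec ρ r s' t
    ξnrec₃ : ∀ {ρ r s t t'} → t ⟶ t' → nrec ρ r s t ⟶ nrec ρ r s t'

  data _⟶c_ : Cmd → Cmd → Set where
    -- [α] μβ.c → c[β := α □]   (β is index 0 in c, α is index suc α there;
    -- afterwards the now-unused binder position 0 is removed)
    μμ    : ∀ {α ρ c} → cmd α (mu ρ c) ⟶c renμC pred (ssubC 0 (suc α) hole c)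
    ξcmd  : ∀ {α t t'} → t ⟶ t' → cmd α t ⟶c cmd α t'

module Submission where

-- The proof is the standard one: each reduction rule is justified by a
-- "substitution-style" typing lemma, and the compatible closure is handled
-- by induction on the reduction.

open import Defs
open import Data.List using (List; _∷_)
open import Data.Nat using (ℕ; zero; suc; pred; _≡ᵇ_)
open import Data.Nat.Properties using (_≟_; ≡ᵇ⇒≡; ≡⇒≡ᵇ)
open import Data.Bool using (true; false)
open import Data.Empty using (⊥-elim)
open import Relation.Nullary using (¬_; yes; no)
open import Relation.Binary.PropositionalEquality using (_≡_; refl; _≢_; cong)

∋-functional : ∀ {Δ γ A B} → Δ ∋ γ ∶ A → Δ ∋ γ ∶ B → A ≡ B
∋-functional here      here      = refl
∋-functional (there p) (there q) = ∋-functional p q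

-- Changing the type of the innermost variable preserves the lookups of all
-- other variables; used whenever a reduction retypes the bound μ-variable.
retype-head : ∀ {Δ γ ρ ρ' τ} → γ ≢ 0 → (ρ ∷ Δ) ∋ γ ∶ τ → (ρ' ∷ Δ) ∋ γ ∶ τ
retype-head γ≢0 here      = ⊥-elim (γ≢0 refl)
retype-head γ≢0 (there p) = there p

_∶_⇒ʳ_ : (ℕ → ℕ) → List Ty → List Ty → Set
f ∶ Γ ⇒ʳ Γ' = ∀ {x τ} → Γ ∋ x ∶ τ → Γ' ∋ f x ∶ τ

lift-⇒ʳ : ∀ {f Γ Γ' σ} → f ∶ Γ ⇒ʳ Γ' → lift f ∶ (σ ∷ Γ) ⇒ʳ (σ ∷ Γ')
lift-⇒ʳ h here      = here
lift-⇒ʳ h (there p) = there (h p)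

mutual
  renλ-⊢ : ∀ {Γ Γ' Δ t ρ} (f : ℕ → ℕ) → f ∶ Γ ⇒ʳ Γ' →
           Γ ⨾ Δ ⊢ t ∶ ρ → Γ' ⨾ Δ ⊢ renλ f t ∶ ρ
  renλ-⊢ f h (⊢var x)      = ⊢var (h x)
  renλ-⊢ f h (⊢lam d)      = ⊢lam (renλ-⊢ (lift f) (lift-⇒ʳ h) d)
  renλ-⊢ f h (⊢app d e)    = ⊢app (renλ-⊢ f h d) (renλ-⊢ f h e)
  renλ-⊢ f h ⊢ze           = ⊢ze
  renλ-⊢ f h (⊢S d)        = ⊢S (renλ-⊢ f h d)
  renλ-⊢ f h (⊢nrec a b c) = ⊢nrec (renλ-⊢ f h a) (renλ-⊢ f h b) (renλ-⊢ f h c)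
  renλ-⊢ f h (⊢mu c)       = ⊢mu (renλC-⊢ f h c)

  renλC-⊢ : ∀ {Γ Γ' Δ c} (f : ℕ → ℕ) → f ∶ Γ ⇒ʳ Γ' →
            Γ ⨾ Δ ⊢c c → Γ' ⨾ Δ ⊢c renλC f c
  renλC-⊢ f h (⊢cmd d x) = ⊢cmd (renλ-⊢ f h d) x

wkλ : ∀ {Γ Δ t ρ σ} → Γ ⨾ Δ ⊢ t ∶ ρ → (σ ∷ Γ) ⨾ Δ ⊢ renλ suc t ∶ ρ
wkλ = renλ-⊢ suc there

mutual
  renμ-⊢ : ∀ {Γ Δ Δ' t ρ} (f : ℕ → ℕ) →
           (∀ {γ τ} → FreeC γ t → Δ ∋ γ ∶ τ → Δ' ∋ f γ ∶ τ) →
           Γ ⨾ Δ ⊢ t ∶ ρ → Γ ⨾ Δ' ⊢ renμ f t ∶ ρ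
  renμ-⊢ f h (⊢var x)      = ⊢var x
  renμ-⊢ f h (⊢lam d)      = ⊢lam (renμ-⊢ f (λ p → h (lam p)) d)
  renμ-⊢ f h (⊢app d e)    =
    ⊢app (renμ-⊢ f (λ p → h (appˡ p)) d) (renμ-⊢ f (λ p → h (appʳ p)) e)
  renμ-⊢ f h ⊢ze           = ⊢ze
  renμ-⊢ f h (⊢S d)        = ⊢S (renμ-⊢ f (λ p → h (S p)) d)
  renμ-⊢ f h (⊢nrec a b c) =
    ⊢nrec (renμ-⊢ f (λ p → h (nrec₁ p)) a) (renμ-⊢ f (λ p → h (nrec₂ p)) b)
          (renμ-⊢ f (λ p → h (nrec₃ p)) c)
  renμ-⊢ f h (⊢mu d)       = ⊢mu (renμC-⊢ (lift f) lifted d)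
    where
    lifted : ∀ {γ τ} → FreeCC γ _ → (_ ∷ _) ∋ γ ∶ τ → (_ ∷ _) ∋ lift f γ ∶ τ
    lifted _ here      = here
    lifted p (there q) = there (h (mu p) q)

  renμC-⊢ : ∀ {Γ Δ Δ' c} (f : ℕ → ℕ) →
            (∀ {γ τ} → FreeCC γ c → Δ ∋ γ ∶ τ → Δ' ∋ f γ ∶ τ) →
            Γ ⨾ Δ ⊢c c → Γ ⨾ Δ' ⊢c renμC f c
  renμC-⊢ f h (⊢cmd d x) = ⊢cmd (renμ-⊢ f (λ p → h (there p)) d) (h here x)

wkμ : ∀ {Γ Δ t ρ σ} → Γ ⨾ Δ ⊢ t ∶ ρ → Γ ⨾ (σ ∷ Δ) ⊢ renμ suc t ∶ ρ
wkμ = renμ-⊢ suc (λ _ q → there q)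

strengthenμ : ∀ {Γ Δ t ρ σ} → ¬ FreeC 0 t →
              Γ ⨾ (σ ∷ Δ) ⊢ t ∶ ρ → Γ ⨾ Δ ⊢ renμ pred t ∶ ρ
strengthenμ 0∉t = renμ-⊢ pred drop
  where
  drop : ∀ {γ τ} → FreeC γ _ → (_ ∷ _) ∋ γ ∶ τ → _ ∋ pred γ ∶ τ
  drop p here      = ⊥-elim (0∉t p)
  drop p (there q) = q

strengthenμC : ∀ {Γ Δ c σ} → ¬ FreeCC 0 c →
               Γ ⨾ (σ ∷ Δ) ⊢c c → Γ ⨾ Δ ⊢c renμC pred c
strengthenμC 0∉c = renμC-⊢ pred drop
  where
  drop : ∀ {γ τ} → FreeCC γ _ → (_ ∷ _) ∋ γ ∶ τ → _ ∋ pred γ ∶ τ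
  drop p here      = ⊥-elim (0∉c p)
  drop p (there q) = q

mutual
  sub-⊢ : ∀ {Γ Γ' Δ t ρ} (σ : ℕ → Term) →
          (∀ {x τ} → Γ ∋ x ∶ τ → Γ' ⨾ Δ ⊢ σ x ∶ τ) →
          Γ ⨾ Δ ⊢ t ∶ ρ → Γ' ⨾ Δ ⊢ sub σ t ∶ ρ
  sub-⊢ σ h (⊢var x)      = h x
  sub-⊢ σ h (⊢lam d)      = ⊢lam (sub-⊢ (exts σ) extended d)
    where
    extended : ∀ {x τ} → (_ ∷ _) ∋ x ∶ τ → (_ ∷ _) ⨾ _ ⊢ exts σ x ∶ τ
    extended here      = ⊢var here
    extended (there p) = wkλ (h p)
  sub-⊢ σ h (⊢app d e)    = ⊢app (sub-⊢ σ h d) (sub-⊢ σ h e)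
  sub-⊢ σ h ⊢ze           = ⊢ze
  sub-⊢ σ h (⊢S d)        = ⊢S (sub-⊢ σ h d)
  sub-⊢ σ h (⊢nrec a b c) = ⊢nrec (sub-⊢ σ h a) (sub-⊢ σ h b) (sub-⊢ σ h c)
  sub-⊢ σ h (⊢mu c)       =
    ⊢mu (subC-⊢ (λ n → renμ suc (σ n)) (λ p → wkμ (h p)) c)

  subC-⊢ : ∀ {Γ Γ' Δ c} (σ : ℕ → Term) →
           (∀ {x τ} → Γ ∋ x ∶ τ → Γ' ⨾ Δ ⊢ σ x ∶ τ) →
           Γ ⨾ Δ ⊢c c → Γ' ⨾ Δ ⊢c subC σ c
  subC-⊢ σ h (⊢cmd d x) = ⊢cmd (sub-⊢ σ h d) x

subst-⊢ : ∀ {Γ Δ t r σ τ} → (σ ∷ Γ) ⨾ Δ ⊢ t ∶ τ → Γ ⨾ Δ ⊢ r ∶ σ →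
          Γ ⨾ Δ ⊢ t [0:= r ] ∶ τ
subst-⊢ {r = r} dt dr = sub-⊢ (single r) typed dt
  where
  typed : ∀ {x τ} → (_ ∷ _) ∋ x ∶ τ → _ ⨾ _ ⊢ single r x ∶ τ
  typed here      = dr
  typed (there p) = ⊢var p

data ⊢E : List Ty → List Ty → ECtx → Ty → Ty → Set where
  ⊢hole  : ∀ {Γ Δ A} → ⊢E Γ Δ hole A A
  ⊢appE  : ∀ {Γ Δ E A σ τ t} → ⊢E Γ Δ E A (σ ⇒ τ) → Γ ⨾ Δ ⊢ t ∶ σ →
           ⊢E Γ Δ (appE E t) A τ
  ⊢sucE  : ∀ {Γ Δ E A} → ⊢E Γ Δ E A nat → ⊢E Γ Δ (sucE E) A nat
  ⊢nrecE : ∀ {Γ Δ E A ρ r s} → ⊢E Γ Δ E A nat → Γ ⨾ Δ ⊢ r ∶ ρ →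
           Γ ⨾ Δ ⊢ s ∶ (nat ⇒ ρ ⇒ ρ) → ⊢E Γ Δ (nrecE ρ r s E) A ρ

plug-⊢ : ∀ {Γ Δ E A B u} → ⊢E Γ Δ E A B → Γ ⨾ Δ ⊢ u ∶ A → Γ ⨾ Δ ⊢ plug E u ∶ B
plug-⊢ ⊢hole          d = d
plug-⊢ (⊢appE e t)    d = ⊢app (plug-⊢ e d) t
plug-⊢ (⊢sucE e)      d = ⊢S (plug-⊢ e d)
plug-⊢ (⊢nrecE e r s) d = ⊢nrec r s (plug-⊢ e d)

wkλE : ∀ {Γ Δ E A B σ} → ⊢E Γ Δ E A B → ⊢E (σ ∷ Γ) Δ (renλE suc E) A B
wkλE ⊢hole          = ⊢hole
wkλE (⊢appE e t)    = ⊢appE (wkλE e) (wkλ t)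
wkλE (⊢sucE e)      = ⊢sucE (wkλE e)
wkλE (⊢nrecE e r s) = ⊢nrecE (wkλE e) (wkλ r) (wkλ s)

wkμE : ∀ {Γ Δ E A B σ} → ⊢E Γ Δ E A B → ⊢E Γ (σ ∷ Δ) (renμE suc E) A B
wkμE ⊢hole          = ⊢hole
wkμE (⊢appE e t)    = ⊢appE (wkμE e) (wkμ t)
wkμE (⊢sucE e)      = ⊢sucE (wkμE e)
wkμE (⊢nrecE e r s) = ⊢nrecE (wkμE e) (wkμ r) (wkμ s)

ssubC-hit : ∀ α δ E q → ssubC α δ E (cmd α q) ≡ cmd δ (plug E (ssub α δ E q))
ssubC-hit α δ E q with α ≡ᵇ α | ≡⇒≡ᵇ α α refl
... | true | _ = refl

ssubC-miss : ∀ {γ α} δ E q → γ ≢ α → ssubC α δ E (cmd γ q) ≡ cmd γ (ssub α δ E q)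
ssubC-miss {γ} {α} δ E q γ≢α with γ ≡ᵇ α | ≡ᵇ⇒≡ γ α
... | true  | eq = ⊥-elim (γ≢α (eq _))
... | false | _  = refl

mutual
  ssub-⊢ : ∀ {Γ Δ Δ' t ρ α δ A B E} → Δ ∋ α ∶ A → Δ' ∋ δ ∶ B → ⊢E Γ Δ' E A B →
           (∀ {γ τ} → γ ≢ α → Δ ∋ γ ∶ τ → Δ' ∋ γ ∶ τ) →
           Γ ⨾ Δ ⊢ t ∶ ρ → Γ ⨾ Δ' ⊢ ssub α δ E t ∶ ρ
  ssub-⊢ a b e h (⊢var x)      = ⊢var x
  ssub-⊢ a b e h (⊢lam d)      = ⊢lam (ssub-⊢ a b (wkλE e) h d)
  ssub-⊢ a b e h (⊢app d d')   = ⊢app (ssub-⊢ a b e h d) (ssub-⊢ a b e h d')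
  ssub-⊢ a b e h ⊢ze           = ⊢ze
  ssub-⊢ a b e h (⊢S d)        = ⊢S (ssub-⊢ a b e h d)
  ssub-⊢ a b e h (⊢nrec x y z) =
    ⊢nrec (ssub-⊢ a b e h x) (ssub-⊢ a b e h y) (ssub-⊢ a b e h z)
  ssub-⊢ a b e h (⊢mu d)       = ⊢mu (ssubC-⊢ (there a) (there b) (wkμE e) lifted d)
    where
    lifted : ∀ {γ τ} → γ ≢ suc _ → (_ ∷ _) ∋ γ ∶ τ → (_ ∷ _) ∋ γ ∶ τ
    lifted γ≢ here      = here
    lifted γ≢ (there q) = there (h (λ eq → γ≢ (cong suc eq)) q)

  ssubC-⊢ : ∀ {Γ Δ Δ' c α δ A B E} → Δ ∋ α ∶ A → Δ' ∋ δ ∶ B → ⊢E Γ Δ' E A B →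
            (∀ {γ τ} → γ ≢ α → Δ ∋ γ ∶ τ → Δ' ∋ γ ∶ τ) →
            Γ ⨾ Δ ⊢c c → Γ ⨾ Δ' ⊢c ssubC α δ E c
  ssubC-⊢ {c = cmd γ q} {α} {δ} {E = E} a b e h (⊢cmd d x) with γ ≟ α
  ... | yes refl rewrite ssubC-hit α δ E q | ∋-functional x a =
    ⊢cmd (plug-⊢ e (ssub-⊢ a b e h d)) b
  ... | no γ≢α rewrite ssubC-miss δ E q γ≢α =
    ⊢cmd (ssub-⊢ a b e h d) (h γ≢α x)

mutual
  ssub-removes : ∀ {α δ} t → α ≢ δ → ¬ FreeC α (ssub α δ hole t)
  ssub-removes (lam ρ t)      α≢δ (lam p)   = ssub-removes t α≢δ p
  ssub-removes (t · s)        α≢δ (appˡ p)  = ssub-removes t α≢δ p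
  ssub-removes (t · s)        α≢δ (appʳ p)  = ssub-removes s α≢δ p
  ssub-removes (mu ρ c)       α≢δ (mu p)    =
    ssubC-removes c (λ eq → α≢δ (cong pred eq)) p
  ssub-removes (S t)          α≢δ (S p)     = ssub-removes t α≢δ p
  ssub-removes (nrec ρ r s t) α≢δ (nrec₁ p) = ssub-removes r α≢δ p
  ssub-removes (nrec ρ r s t) α≢δ (nrec₂ p) = ssub-removes s α≢δ p
  ssub-removes (nrec ρ r s t) α≢δ (nrec₃ p) = ssub-removes t α≢δ p

  ssubC-removes : ∀ {α δ} c → α ≢ δ → ¬ FreeCC α (ssubC α δ hole c)
  ssubC-removes {α} {δ} (cmd γ q) α≢δ with γ ≟ α
  ... | yes refl rewrite ssubC-hit α δ hole q = λ
    { here      → α≢δ refl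
    ; (there p) → ssub-removes q α≢δ p }
  ... | no γ≢α rewrite ssubC-miss δ hole q γ≢α = λ
    { here      → γ≢α refl
    ; (there p) → ssub-removes q α≢δ p }

mutual
  subject-reduction : ∀ {Γ Δ t t' ρ} → Γ ⨾ Δ ⊢ t ∶ ρ → t ⟶ t' → Γ ⨾ Δ ⊢ t' ∶ ρ
  subject-reduction (⊢app (⊢lam d) e) β = subst-⊢ d e
  subject-reduction (⊢S (⊢mu d)) μS =
    ⊢mu (ssubC-⊢ here here (⊢sucE ⊢hole) retype-head d)
  subject-reduction (⊢app (⊢mu d) e) μapp =
    ⊢mu (ssubC-⊢ here here (⊢appE ⊢hole (wkμ e)) retype-head d)
  subject-reduction (⊢mu (⊢cmd d here)) (μη 0∉t) = strengthenμ 0∉t d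
  subject-reduction (⊢nrec dr ds dt) nrec0 = dr
  subject-reduction (⊢nrec dr ds (⊢S dn)) nrecS =
    ⊢app (⊢app ds dn) (⊢nrec dr ds dn)
  subject-reduction (⊢nrec dr ds (⊢mu d)) nrecμ =
    ⊢mu (ssubC-⊢ here here (⊢nrecE ⊢hole (wkμ dr) (wkμ ds)) retype-head d)
  subject-reduction (⊢lam d)      (ξlam r)   = ⊢lam (subject-reduction d r)
  subject-reduction (⊢app d e)    (ξappˡ r)  = ⊢app (subject-reduction d r) e
  subject-reduction (⊢app d e)    (ξappʳ r)  = ⊢app d (subject-reduction e r)
  subject-reduction (⊢mu c)       (ξmu r)    = ⊢mu (subject-reductionC c r)
  subject-reduction (⊢S d)        (ξS r)     = ⊢S (subject-reduction d r)
  subject-reduction (⊢nrec a b c) (ξnrec₁ r) = ⊢nrec (subject-reduction a r) b c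
  subject-reduction (⊢nrec a b c) (ξnrec₂ r) = ⊢nrec a (subject-reduction b r) c
  subject-reduction (⊢nrec a b c) (ξnrec₃ r) = ⊢nrec a b (subject-reduction c r)

  -- μμ: c[β := α □] is typed in the context extended by the now unused β,
  -- which strengthening removes.
  subject-reductionC : ∀ {Γ Δ c c'} → Γ ⨾ Δ ⊢c c → c ⟶c c' → Γ ⨾ Δ ⊢c c'
  subject-reductionC {c = cmd α (mu ρ c)} (⊢cmd (⊢mu d) x) μμ =
    strengthenμC (ssubC-removes c (λ ()))
                 (ssubC-⊢ here (there x) ⊢hole (λ _ q → q) d)
  subject-reductionC (⊢cmd d x) (ξcmd r) = ⊢cmd (subject-reduction d r) x

theorem3p20 : (Γ Δ : List Ty) (t t' : Term) (ρ : Ty) →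
    Γ ⨾ Δ ⊢ t ∶ ρ → t ⟶ t' → Γ ⨾ Δ ⊢ t' ∶ ρ
theorem3p20 Γ Δ t t' ρ = subject-reduction
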